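{- Let $\mathbf{h}$ be the fixed point starting with $0$ of the morphism $0\mapsto01$, $1\mapsto12$, $2\mapsto2$. Then the abelian complexity $b^{(1)}_{\mathbf{h}}$ is unbounded and $b^{(1)}_{\mathbf{h}}(n)<b^{(2)}_{\mathbf{h}}(n)<p_{\mathbf{h}}(n)$ for all $n\ge6$.
   Context: For words $u,w$, $\binom{u}{w}$ is the number of occurrences of $w$ as a scattered subword of $u$; $u\sim_j v$ if $\binom{u}{x}=\binom{v}{x}$ for all words $x$ of length at most $j$. $b^{(j)}_{\mathbf{x}}(n)$ is the number of $\sim_j$-classes among length-$n$ factors of $\mathbf{x}$, and $p_{\mathbf{x}}(n)$ is the number of length-$n$ factors. -}

module Defs where

open import Data.Nat using (ℕ; zero; suc; _+_; _≤_)
open import Data.Fin using (Fin; zero; suc; _≟_)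
open import Data.List using (List; []; _∷_; _++_; concatMap; length; map; upTo)
open import Data.List.Relation.Unary.All using (All)
open import Data.List.Relation.Unary.Any using (Any)
open import Data.List.Relation.Unary.AllPairs using (AllPairs)
open import Data.Product using (Σ; ∃; _×_)
open import Relation.Nullary using (¬_; yes; no)
open import Relation.Binary.PropositionalEquality using (_≡_)

Letter : Set
Letter = Fin 3

Word : Set
Word = List Letter

σ : Letter → Word
σ zero = zero ∷ suc zero ∷ []
σ (suc zero) = suc zero ∷ suc (suc zero) ∷ []
σ (suc (suc zero)) = suc (suc zero) ∷ []

σ* : Word → Word
σ* = concatMap σ

σpow : ℕ → Word
σpow zero = zero ∷ []
σpow (suc k) = σ* (σpow k)

-- i-th letter of a word, with default 0 when out of range
nth : Word → ℕ → Letter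
nth [] _ = zero
nth (a ∷ u) zero = a
nth (a ∷ u) (suc i) = nth u i

-- The fixed point h = lim σ^k(0) starting with 0.
-- σ^(i+1)(0) has length (i+2)(i+3)/2 > i, and each σ^k(0) is a prefix of σ^(k+1)(0),
-- so h i is the i-th letter of the fixed point.
h : ℕ → Letter
h i = nth (σpow (suc i)) i

factor : (x : ℕ → Letter) → ℕ → ℕ → Word
factor x i n = map (λ k → x (i + k)) (upTo n)

-- binomial coefficient of words: number of occurrences of w as a scattered subword of u
binom : Word → Word → ℕ
binom u [] = 1
binom [] (b ∷ w) = 0
binom (a ∷ u) (b ∷ w) with a ≟ b
... | yes _ = binom u (b ∷ w) + binom u w
... | no _ = binom u (b ∷ w)

_∼[_]_ : Word → ℕ → Word → Set
u ∼[ j ] v = ∀ (x : Word) → length x ≤ j → binom u x ≡ binom v x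

-- NumClasses x R n k : the length-n factors of x fall into exactly k classes of R,
-- witnessed by a list of k length-n factors, pairwise non-R-related, such that
-- every length-n factor is R-related to one of them.
NumClasses : (ℕ → Letter) → (Word → Word → Set) → ℕ → ℕ → Set
NumClasses x R n k =
  Σ (List Word) λ reps →
    (length reps ≡ k)
    × All (λ w → ∃ λ i → factor x i n ≡ w) reps
    × AllPairs (λ u v → ¬ R u v) reps
    × (∀ i → Any (R (factor x i n)) reps)

BinomComplexity : (ℕ → Letter) → ℕ → ℕ → ℕ → Set
BinomComplexity x j n k = NumClasses x (λ u v → u ∼[ j ] v) n k

FactorComplexity : (ℕ → Letter) → ℕ → ℕ → Set
FactorComplexity x n k = NumClasses x _≡_ n k

-- Since σ(1 2ᵏ) = 1 2ᵏ⁺¹, the fixed point is h = 0 B₀ B₁ B₂ ⋯ with blocks Bₖ = 1 2ᵏ, and Bₖ starts at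
-- position 1 + k(k+1)/2. Far out, a window of length n meets at most one block start and is determined by its
-- distance to that start, clipped at n; so every factor of length n already occurs before block n + 1, and the
-- classes of a decidable equivalence are obtained by deduplicating this finite list of factors.
-- Sliding a window of length k(k+1)/2 from position 1, where it reads B₀ ⋯ Bₖ₋₁ and contains k letters 1, into a
-- long run of 2s changes its number of 1s by at most one per step, so all k + 1 values 0, …, k occur.
-- For n ≥ 6, the factors 1 2ⁿ⁻¹ and 2 1 2ⁿ⁻² are abelian equivalent but differ in the number of subwords 12, while
-- 2 1 2ⁿ⁻⁴ 1 2 and 1 2ⁿ⁻² 1 are distinct yet 2-binomially equivalent, as exchanging the end pieces 21 and 12
-- preserves all binomial coefficients of length ≤ 2. A finer equivalence separating two factors that are
-- equivalent for a coarser one has strictly more classes.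

module Submission where

open import Defs
open import Data.Nat using (ℕ; _<_; _≤_)
open import Data.Product using (Σ; ∃; _×_)

open import Level using (0ℓ)
open import Data.Nat using (zero; suc; _+_; _*_; _∸_; _⊓_; z≤n; s≤s; _≤?_; _≤′_; ≤′-refl; ≤′-step)
open import Data.Nat.Properties hiding (_≟_)
open import Data.Nat.Properties using () renaming (_≟_ to _≟ℕ_)
open import Data.Nat.Tactic.RingSolver using (solve-∀)
open import Data.Fin as Fin using (Fin; toℕ; _≟_)
open import Data.Fin.Properties using (all?; toℕ-injective; toℕ<n)
open import Data.List using (List; []; _∷_; _++_; length; map; replicate; upTo; applyUpTo; deduplicate)
open import Data.List.Properties
  using (≡-dec; length-++; length-replicate; length-removeAt′; length-tabulate; concatMap-++;
         map-cong; map-cong-local; map-∘; map-upTo)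
open import Data.List.Membership.Propositional using () renaming (_∈_ to _∈ₚ_)
open import Data.List.Membership.Propositional.Properties using (∈-upTo⁻; ∈-applyUpTo⁺)
import Data.List.Membership.Setoid as SetoidMembership
open import Data.List.Relation.Unary.All as All using (All; []; _∷_)
import Data.List.Relation.Unary.All.Properties as All
open import Data.List.Relation.Unary.Any as Any using (Any; here; there; any?; _─_)
import Data.List.Relation.Unary.Any.Properties as Any
open import Data.List.Relation.Unary.AllPairs as AllPairs using ([]; _∷_)
import Data.List.Relation.Unary.Unique.Setoid as SetoidUnique
open import Data.List.Relation.Unary.Unique.Setoid.Properties using (tabulate⁺)
open import Data.List.Relation.Unary.Unique.DecSetoid.Properties using (deduplicate-!)
open import Data.Product using (_,_; proj₁; proj₂; ∃₂)
open import Data.Sum using (_⊎_; inj₁; inj₂)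
open import Data.Empty using (⊥-elim)
open import Function using (_∘_)
open import Relation.Nullary using (¬_; yes; no)
open import Relation.Nullary.Decidable using (Dec; map′; _×-dec_)
open import Relation.Binary using (Rel; Setoid; DecSetoid; IsEquivalence; IsDecEquivalence)
open import Relation.Binary.PropositionalEquality as ≡ using (_≡_; cong; cong₂)

module _ {a ℓ} (S : Setoid a ℓ) where
  open Setoid S renaming (Carrier to A)
  open SetoidMembership S using (_∈_)
  open SetoidUnique S using (Unique)

  ∈-─⁺ : ∀ {x y ys} (x∈ys : x ∈ ys) → y ∈ ys → x ≉ y → y ∈ (ys ─ x∈ys)
  ∈-─⁺ (here x≈z)   (here y≈z)   x≉y = ⊥-elim (x≉y (trans x≈z (sym y≈z)))
  ∈-─⁺ (here _)     (there y∈ys) _   = y∈ys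
  ∈-─⁺ (there _)    (here y≈z)   _   = here y≈z
  ∈-─⁺ (there x∈ys) (there y∈ys) x≉y = there (∈-─⁺ x∈ys y∈ys x≉y)

  unique-length-≤ : ∀ {xs ys} → Unique xs → All (_∈ ys) xs → length xs ≤ length ys
  unique-length-≤ [] [] = z≤n
  unique-length-≤ {ys = ys} (x≉xs ∷ xs!) (x∈ys ∷ xs⊆ys) = begin
    suc _                     ≤⟨ s≤s (unique-length-≤ xs! xs⊆ys─x) ⟩
    suc (length (ys ─ x∈ys))  ≡⟨ length-removeAt′ ys (Any.index x∈ys) ⟨
    length ys                 ∎
    where
    open ≤-Reasoning
    xs⊆ys─x = All.zipWith (λ (x≉y , y∈ys) → ∈-─⁺ x∈ys y∈ys x≉y) (x≉xs , xs⊆ys)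

  unique-lookup-≡ : ∀ {p q} {P : A → Set p} {Q : A → Set q} {xs} → Unique xs →
                    (i : Any P xs) (j : Any Q xs) → Any.lookup i ≈ Any.lookup j → Any.lookup i ≡ Any.lookup j
  unique-lookup-≡ _          (here _)  (here _)  _   = ≡.refl
  unique-lookup-≡ (x≉xs ∷ _) (here _)  (there j) x≈  = ⊥-elim (proj₁ (All.lookupAny x≉xs j) x≈)
  unique-lookup-≡ (x≉xs ∷ _) (there i) (here _)  ≈x  = ⊥-elim (proj₁ (All.lookupAny x≉xs i) (sym ≈x))
  unique-lookup-≡ (_ ∷ xs!)  (there i) (there j) i≈j = unique-lookup-≡ xs! i j i≈j

  module _ {ℓ′} {_≈′_ : Rel A ℓ′} (≈′-isDecEquivalence : IsDecEquivalence _≈′_)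
           (≈′⇒≈ : ∀ {x y} → x ≈′ y → x ≈ y) where
    open IsDecEquivalence ≈′-isDecEquivalence renaming (sym to sym′; trans to trans′; _≟_ to _≟′_)

    unique⇒one-of-∉′ : ∀ {p} {P : A → Set p} {xs u v} → Unique xs → P u → P v → u ≈ v → ¬ u ≈′ v →
                       ∃ λ w → P w × All (λ y → ¬ w ≈′ y) xs
    unique⇒one-of-∉′ {xs = xs} {u} {v} xs! Pu Pv u≈v u≉′v with any? (u ≟′_) xs | any? (v ≟′_) xs
    ... | no u∉ | _     = u , Pu , All.¬Any⇒All¬ xs u∉
    ... | yes _ | no v∉ = v , Pv , All.¬Any⇒All¬ xs v∉
    ... | yes i | yes j = ⊥-elim (u≉′v (trans′ (Any.lookup-result i)
                            (≡.subst (_≈′ v) (≡.sym same) (sym′ (Any.lookup-result j)))))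
      where
      same : Any.lookup i ≡ Any.lookup j
      same = unique-lookup-≡ xs! i j
        (trans (sym (≈′⇒≈ (Any.lookup-result i))) (trans u≈v (≈′⇒≈ (Any.lookup-result j))))

∼-refl : ∀ {j} u → u ∼[ j ] u
∼-refl u x _ = ≡.refl

∼-sym : ∀ {j u v} → u ∼[ j ] v → v ∼[ j ] u
∼-sym u∼v x ∣x∣≤j = ≡.sym (u∼v x ∣x∣≤j)

∼-trans : ∀ {j u v w} → u ∼[ j ] v → v ∼[ j ] w → u ∼[ j ] w
∼-trans u∼v v∼w x ∣x∣≤j = ≡.trans (u∼v x ∣x∣≤j) (v∼w x ∣x∣≤j)

∼-weaken : ∀ {i j u v} → i ≤ j → u ∼[ j ] v → u ∼[ i ] v
∼-weaken i≤j u∼v x ∣x∣≤i = u∼v x (≤-trans ∣x∣≤i i≤j)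

≡⇒∼ : ∀ {j u v} → u ≡ v → u ∼[ j ] v
≡⇒∼ ≡.refl = ∼-refl _

all-words? : ∀ {p} {P : Word → Set p} → (∀ x → Dec (P x)) → ∀ j → Dec (∀ x → length x ≤ j → P x)
all-words? P? zero = map′ (λ P[] → λ { [] _ → P[] }) (λ ∀P → ∀P [] z≤n) (P? [])
all-words? P? (suc j) = map′
  (λ (P[] , ∀P∷) → λ { [] _ → P[] ; (a ∷ x) (s≤s ∣x∣≤j) → ∀P∷ a x ∣x∣≤j })
  (λ ∀P → ∀P [] z≤n , λ a x ∣x∣≤j → ∀P (a ∷ x) (s≤s ∣x∣≤j))
  (P? [] ×-dec all? (λ a → all-words? (P? ∘ (a ∷_)) j))

∼-isEquivalence : ∀ j → IsEquivalence (_∼[ j ]_)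
∼-isEquivalence j = record { refl = ∼-refl _ ; sym = ∼-sym ; trans = ∼-trans }

∼-isDecEquivalence : ∀ j → IsDecEquivalence (_∼[ j ]_)
∼-isDecEquivalence j = record
  { isEquivalence = ∼-isEquivalence j
  ; _≟_           = λ u v → all-words? (λ x → binom u x ≟ℕ binom v x) j
  }

binom₁ : Word → Letter → ℕ
binom₁ u a = binom u (a ∷ [])

binom₂ : Word → Letter → Letter → ℕ
binom₂ u a b = binom u (a ∷ b ∷ [])

binom₁-∷-≤ : ∀ b w a → binom₁ (b ∷ w) a ≤ suc (binom₁ w a)
binom₁-∷-≤ b w a with b ≟ a
... | yes _ = ≤-reflexive (+-comm (binom₁ w a) 1)
... | no _  = n≤1+n (binom₁ w a)

binom₁-++ : ∀ u v a → binom₁ (u ++ v) a ≡ binom₁ u a + binom₁ v a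
binom₁-++ []      v a = ≡.refl
binom₁-++ (c ∷ u) v a with c ≟ a
... | no _  = binom₁-++ u v a
... | yes _ = ≡.trans (cong (_+ 1) (binom₁-++ u v a)) (+-right-comm (binom₁ u a) (binom₁ v a) 1)
  where
  +-right-comm : ∀ x y z → x + y + z ≡ x + z + y
  +-right-comm = solve-∀

binom₂-++ : ∀ u v a b → binom₂ (u ++ v) a b ≡ binom₂ u a b + binom₁ u a * binom₁ v b + binom₂ v a b
binom₂-++ []      v a b = ≡.refl
binom₂-++ (c ∷ u) v a b with c ≟ a
... | no _  = binom₂-++ u v a b
... | yes _ = ≡.trans (cong₂ _+_ (binom₂-++ u v a b) (binom₁-++ u v b))
                      (regroup (binom₂ u a b) (binom₁ u a) (binom₁ v b) (binom₂ v a b) (binom₁ u b))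
  where
  regroup : ∀ u₂ ua vb v₂ ub → u₂ + ua * vb + v₂ + (ub + vb) ≡ u₂ + ub + (ua + 1) * vb + v₂
  regroup = solve-∀

∼₂-from-binoms : ∀ {u v} → (∀ a → binom₁ u a ≡ binom₁ v a) → (∀ a b → binom₂ u a b ≡ binom₂ v a b) →
                 u ∼[ 2 ] v
∼₂-from-binoms _  _  []              _ = ≡.refl
∼₂-from-binoms u₁ _  (a ∷ [])        _ = u₁ a
∼₂-from-binoms _  u₂ (a ∷ b ∷ [])    _ = u₂ a b
∼₂-from-binoms _  _  (_ ∷ _ ∷ _ ∷ _) (s≤s (s≤s ()))

-- After expanding both sides, p and q enter only through their (equal) Parikh vectors and through
-- binom₂ p + binom₂ q.
swap-ends-∼₂ : ∀ p m q → (∀ a → binom₁ p a ≡ binom₁ q a) → (p ++ m ++ q) ∼[ 2 ] (q ++ m ++ p)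
swap-ends-∼₂ p m q p≈q = ∼₂-from-binoms same₁ same₂
  where
  open ≡.≡-Reasoning

  expand₁ : ∀ x y a → binom₁ (x ++ m ++ y) a ≡ binom₁ x a + (binom₁ m a + binom₁ y a)
  expand₁ x y a = ≡.trans (binom₁-++ x (m ++ y) a) (cong (binom₁ x a +_) (binom₁-++ m y a))

  expand₂ : ∀ x y a b → binom₂ (x ++ m ++ y) a b
            ≡ binom₂ x a b + binom₁ x a * (binom₁ m b + binom₁ y b)
              + (binom₂ m a b + binom₁ m a * binom₁ y b + binom₂ y a b)
  expand₂ x y a b = ≡.trans (binom₂-++ x (m ++ y) a b)
    (cong₂ (λ s t → binom₂ x a b + binom₁ x a * s + t) (binom₁-++ m y b) (binom₂-++ m y a b))

  swap-outer : ∀ x y s t u → x + s + (t + u + y) ≡ y + s + (t + u + x)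
  swap-outer = solve-∀

  same₁ : ∀ a → binom₁ (p ++ m ++ q) a ≡ binom₁ (q ++ m ++ p) a
  same₁ a = begin
    binom₁ (p ++ m ++ q) a                  ≡⟨ expand₁ p q a ⟩
    binom₁ p a + (binom₁ m a + binom₁ q a)  ≡⟨ cong₂ (λ s t → s + (binom₁ m a + t)) (p≈q a) (≡.sym (p≈q a)) ⟩
    binom₁ q a + (binom₁ m a + binom₁ p a)  ≡⟨ expand₁ q p a ⟨
    binom₁ (q ++ m ++ p) a                  ∎

  same₂ : ∀ a b → binom₂ (p ++ m ++ q) a b ≡ binom₂ (q ++ m ++ p) a b
  same₂ a b = begin
    binom₂ (p ++ m ++ q) a b
      ≡⟨ expand₂ p q a b ⟩
    binom₂ p a b + binom₁ p a * (binom₁ m b + binom₁ q b) + (binom₂ m a b + binom₁ m a * binom₁ q b + binom₂ q a b)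
      ≡⟨ cong₂ (λ s t → binom₂ p a b + s * (binom₁ m b + t) + (binom₂ m a b + binom₁ m a * t + binom₂ q a b))
               (p≈q a) (≡.sym (p≈q b)) ⟩
    binom₂ p a b + binom₁ q a * (binom₁ m b + binom₁ p b) + (binom₂ m a b + binom₁ m a * binom₁ p b + binom₂ q a b)
      ≡⟨ swap-outer (binom₂ p a b) (binom₂ q a b) _ (binom₂ m a b) (binom₁ m a * binom₁ p b) ⟩
    binom₂ q a b + binom₁ q a * (binom₁ m b + binom₁ p b) + (binom₂ m a b + binom₁ m a * binom₁ p b + binom₂ p a b)
      ≡⟨ expand₂ q p a b ⟨
    binom₂ (q ++ m ++ p) a b
      ∎

one two : Letter
one = Fin.suc Fin.zero
two = Fin.suc (Fin.suc Fin.zero)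

12-∼₁-21 : ∀ w → (one ∷ two ∷ w) ∼[ 1 ] (two ∷ one ∷ w)
12-∼₁-21 w []                                  _ = ≡.refl
12-∼₁-21 w (Fin.zero ∷ [])                     _ = ≡.refl
12-∼₁-21 w (Fin.suc Fin.zero ∷ [])             _ = ≡.refl
12-∼₁-21 w (Fin.suc (Fin.suc Fin.zero) ∷ [])   _ = ≡.refl
12-∼₁-21 w (_ ∷ _ ∷ _)                         (s≤s ())

12-≁₂-21 : ∀ w → ¬ (one ∷ two ∷ w) ∼[ 2 ] (two ∷ one ∷ w)
12-≁₂-21 w 12∼21 = m+1+n≢m (binom₁ w two)
  (+-cancelˡ-≡ (binom₂ w one two) _ _ (12∼21 (one ∷ two ∷ []) (s≤s (s≤s z≤n))))

21⋯12-∼₂-12⋯21 : ∀ m → ((two ∷ one ∷ []) ++ m ++ (one ∷ two ∷ [])) ∼[ 2 ] ((one ∷ two ∷ []) ++ m ++ (two ∷ one ∷ []))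
21⋯12-∼₂-12⋯21 m = swap-ends-∼₂ (two ∷ one ∷ []) m (one ∷ two ∷ []) same-letters
  where
  same-letters : ∀ a → binom₁ (two ∷ one ∷ []) a ≡ binom₁ (one ∷ two ∷ []) a
  same-letters Fin.zero                    = ≡.refl
  same-letters (Fin.suc Fin.zero)          = ≡.refl
  same-letters (Fin.suc (Fin.suc Fin.zero)) = ≡.refl

IsFactor : (ℕ → Letter) → ℕ → Word → Set
IsFactor x n w = ∃ λ i → factor x i n ≡ w

module _ (x : ℕ → Letter) where

  factor-≡-map : ∀ i n {f : ℕ → Letter} → (∀ m → m < n → x (i + m) ≡ f m) → factor x i n ≡ map f (upTo n)
  factor-≡-map i n agree = map-cong-local (All.tabulate λ m∈ → agree _ (∈-upTo⁻ m∈))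

  factor-suc : ∀ i n → factor x i (suc n) ≡ x i ∷ factor x (suc i) n
  factor-suc i n = cong₂ _∷_ (cong x (+-identityʳ i)) (begin
    map x[i+_] (applyUpTo suc n)   ≡⟨ cong (map x[i+_]) (map-upTo suc n) ⟨
    map x[i+_] (map suc (upTo n))  ≡⟨ map-∘ (upTo n) ⟨
    map (x[i+_] ∘ suc) (upTo n)    ≡⟨ map-cong (λ k → cong x (+-suc i k)) (upTo n) ⟩
    factor x (suc i) n             ∎)
    where
    open ≡.≡-Reasoning
    x[i+_] : ℕ → Letter
    x[i+ k ] = x (i + k)

  factor-++ : ∀ i a b → factor x i (a + b) ≡ factor x i a ++ factor x (i + a) b
  factor-++ i zero    b = cong (λ j → factor x j b) (≡.sym (+-identityʳ i))
  factor-++ i (suc a) b = begin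
    factor x i (suc (a + b))                              ≡⟨ factor-suc i (a + b) ⟩
    x i ∷ factor x (suc i) (a + b)                        ≡⟨ cong (x i ∷_) (factor-++ (suc i) a b) ⟩
    x i ∷ (factor x (suc i) a ++ factor x (suc i + a) b)  ≡⟨ cong (λ j → x i ∷ (factor x (suc i) a ++ factor x j b))
                                                                  (+-suc i a) ⟨
    (x i ∷ factor x (suc i) a) ++ factor x (i + suc a) b  ≡⟨ cong (_++ factor x (i + suc a) b) (factor-suc i a) ⟨
    factor x i (suc a) ++ factor x (i + suc a) b          ∎
    where open ≡.≡-Reasoning

  factor-≡ : ∀ i w → (∀ m → m < length w → x (i + m) ≡ nth w m) → factor x i (length w) ≡ w
  factor-≡ i []      _     = ≡.refl
  factor-≡ i (a ∷ w) agree = ≡.trans (factor-suc i (length w))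
    (cong₂ _∷_ (≡.trans (cong x (≡.sym (+-identityʳ i))) (agree 0 (s≤s z≤n)))
               (factor-≡ (suc i) w λ m m<∣w∣ → ≡.trans (cong x (≡.sym (+-suc i m))) (agree (suc m) (s≤s m<∣w∣))))

  factor-const : ∀ i n {a} → (∀ m → m < n → x (i + m) ≡ a) → factor x i n ≡ replicate n a
  factor-const i zero    _     = ≡.refl
  factor-const i (suc n) const = ≡.trans (factor-suc i n)
    (cong₂ _∷_ (≡.trans (cong x (≡.sym (+-identityʳ i))) (const 0 (s≤s z≤n)))
               (factor-const (suc i) n λ m m<n → ≡.trans (cong x (≡.sym (+-suc i m))) (const (suc m) (s≤s m<n))))

  binom₁-factor-slide : ∀ i n a → binom₁ (factor x i n) a ≤ suc (binom₁ (factor x (suc i) n) a)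
  binom₁-factor-slide i n a = begin
    binom₁ (factor x i n) a                                  ≤⟨ m≤m+n _ _ ⟩
    binom₁ (factor x i n) a + binom₁ (factor x (i + n) 1) a  ≡⟨ binom₁-++ (factor x i n) _ a ⟨
    binom₁ (factor x i n ++ factor x (i + n) 1) a            ≡⟨ cong (λ w → binom₁ w a) (factor-++ i n 1) ⟨
    binom₁ (factor x i (n + 1)) a                            ≡⟨ cong (λ l → binom₁ (factor x i l) a) (+-comm n 1) ⟩
    binom₁ (factor x i (suc n)) a                            ≡⟨ cong (λ w → binom₁ w a) (factor-suc i n) ⟩
    binom₁ (x i ∷ factor x (suc i) n) a                      ≤⟨ binom₁-∷-≤ (x i) _ a ⟩
    suc (binom₁ (factor x (suc i) n) a)                      ∎
    where open ≤-Reasoning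

module _ {R : Rel Word 0ℓ} (R-isEquivalence : IsEquivalence R) (x : ℕ → Letter) {n : ℕ} where
  private
    R-setoid : Setoid 0ℓ 0ℓ
    R-setoid = record { isEquivalence = R-isEquivalence }

  numClasses-≥ : ∀ {k ws} → NumClasses x R n k → SetoidUnique.Unique R-setoid ws → All (IsFactor x n) ws →
                 length ws ≤ k
  numClasses-≥ (reps , ≡.refl , _ , _ , covers) ws! ws-factors =
    unique-length-≤ R-setoid ws! (All.map (λ { (i , ≡.refl) → covers i }) ws-factors)

module _ {R R′ : Rel Word 0ℓ} (R-isEquivalence : IsEquivalence R) (R′-isDecEquivalence : IsDecEquivalence R′)
         (R′⇒R : ∀ {u v} → R′ u v → R u v) (x : ℕ → Letter) {n : ℕ} where

  numClasses-< : ∀ {k k′ u v} → NumClasses x R n k → NumClasses x R′ n k′ →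
                 IsFactor x n u → IsFactor x n v → R u v → ¬ R′ u v → k < k′
  numClasses-< (reps , ≡.refl , reps-factors , reps! , _) classes′ fu fv u≈v u≉′v
    with unique⇒one-of-∉′ (record { isEquivalence = R-isEquivalence }) R′-isDecEquivalence R′⇒R reps! fu fv u≈v u≉′v
  ... | w , fw , w≉′reps = numClasses-≥ (IsDecEquivalence.isEquivalence R′-isDecEquivalence) x classes′
                             (w≉′reps ∷ AllPairs.map (_∘ R′⇒R) reps!) (fw ∷ reps-factors)

module _ {R : Rel Word 0ℓ} (R-isDecEquivalence : IsDecEquivalence R) {x : ℕ → Letter} {n : ℕ} where
  private
    R-decSetoid : DecSetoid 0ℓ 0ℓ
    R-decSetoid = record { isDecEquivalence = R-isDecEquivalence }
    open DecSetoid R-decSetoid using (refl; sym; trans) renaming (_≟_ to _≟R_)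

  numClasses-deduplicate : ∀ L → All (IsFactor x n) L → (∀ i → factor x i n ∈ₚ L) →
                           NumClasses x R n (length (deduplicate _≟R_ L))
  numClasses-deduplicate L L-factors L-covers =
    deduplicate _≟R_ L , ≡.refl , All.deduplicate⁺ _≟R_ L-factors , deduplicate-! R-decSetoid L ,
    λ i → Any.deduplicate⁺ _≟R_ (λ b≈a w≈a → trans w≈a (sym b≈a)) (Any.map (λ { ≡.refl → refl }) (L-covers i))

nth-++ˡ : ∀ u v {i} → i < length u → nth (u ++ v) i ≡ nth u i
nth-++ˡ (a ∷ u) v {zero}  _            = ≡.refl
nth-++ˡ (a ∷ u) v {suc i} (s≤s i<∣u∣) = nth-++ˡ u v i<∣u∣

nth-++ʳ : ∀ u v i → nth (u ++ v) (length u + i) ≡ nth v i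
nth-++ʳ []      v i = ≡.refl
nth-++ʳ (a ∷ u) v i = nth-++ʳ u v i

triangular : ℕ → ℕ
triangular zero    = 0
triangular (suc k) = triangular k + suc k

triangular-mono-≤ : ∀ {k K} → k ≤ K → triangular k ≤ triangular K
triangular-mono-≤ z≤n       = z≤n
triangular-mono-≤ (s≤s k≤K) = +-mono-≤ (triangular-mono-≤ k≤K) (s≤s k≤K)

triangular-cancel-< : ∀ {k K} → triangular k < triangular K → k < K
triangular-cancel-< Tk<TK = ≰⇒> (λ K≤k → <⇒≱ Tk<TK (triangular-mono-≤ K≤k))

n≤triangular : ∀ k → k ≤ triangular k
n≤triangular zero    = z≤n
n≤triangular (suc k) = m≤n+m (suc k) (triangular k)

block : ℕ → Word
block k = one ∷ replicate k two

blocks : ℕ → Word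
blocks zero    = []
blocks (suc k) = blocks k ++ block k

blockStart : ℕ → ℕ
blockStart k = suc (triangular k)

blockLetter : ℕ → Letter
blockLetter zero    = one
blockLetter (suc _) = two

σ*-replicate-two : ∀ k → σ* (replicate k two) ≡ replicate k two
σ*-replicate-two zero    = ≡.refl
σ*-replicate-two (suc k) = cong (two ∷_) (σ*-replicate-two k)

σ*-block : ∀ k → σ* (block k) ≡ block (suc k)
σ*-block k = cong (λ w → one ∷ two ∷ w) (σ*-replicate-two k)

σ*-blocks : ∀ k → one ∷ σ* (blocks k) ≡ blocks (suc k)
σ*-blocks zero    = ≡.refl
σ*-blocks (suc k) = begin
  one ∷ σ* (blocks k ++ block k)       ≡⟨ cong (one ∷_) (concatMap-++ σ (blocks k) (block k)) ⟩
  one ∷ σ* (blocks k) ++ σ* (block k)  ≡⟨ cong₂ _++_ (σ*-blocks k) (σ*-block k) ⟩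
  blocks (suc k) ++ block (suc k)      ∎
  where open ≡.≡-Reasoning

σpow≡0∷blocks : ∀ k → σpow k ≡ Fin.zero ∷ blocks k
σpow≡0∷blocks zero    = ≡.refl
σpow≡0∷blocks (suc k) = ≡.trans (cong σ* (σpow≡0∷blocks k)) (cong (Fin.zero ∷_) (σ*-blocks k))

length-blocks : ∀ k → length (blocks k) ≡ triangular k
length-blocks zero    = ≡.refl
length-blocks (suc k) =
  ≡.trans (length-++ (blocks k)) (cong₂ _+_ (length-blocks k) (cong suc (length-replicate k)))

nth-block : ∀ {k t} → t ≤ k → nth (block k) t ≡ blockLetter t
nth-block {t = zero}      _         = ≡.refl
nth-block {suc k} {suc t} (s≤s t≤k) = nth-replicate t≤k
  where
  nth-replicate : ∀ {k t} → t ≤ k → nth (replicate (suc k) two) t ≡ two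
  nth-replicate {t = zero}      _         = ≡.refl
  nth-replicate {suc k} {suc t} (s≤s t≤k) = nth-replicate t≤k

nth-blocks-mono : ∀ {m k K} → m < triangular k → k ≤′ K → nth (blocks K) m ≡ nth (blocks k) m
nth-blocks-mono m<Tk ≤′-refl = ≡.refl
nth-blocks-mono {K = suc K} m<Tk (≤′-step k≤K) = ≡.trans
  (nth-++ˡ (blocks K) (block K)
    (≤-trans m<Tk (≤-trans (triangular-mono-≤ (≤′⇒≤ k≤K)) (≤-reflexive (≡.sym (length-blocks K))))))
  (nth-blocks-mono m<Tk k≤K)

h-suc : ∀ {m} K → m < triangular K → h (suc m) ≡ nth (blocks K) m
h-suc {m} K m<TK = ≡.trans (cong (λ w → nth w (suc m)) (σpow≡0∷blocks (2 + m))) (agree (≤-total K (2 + m)))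
  where
  agree : K ≤ 2 + m ⊎ 2 + m ≤ K → nth (blocks (2 + m)) m ≡ nth (blocks K) m
  agree (inj₁ K≤) = nth-blocks-mono m<TK (≤⇒≤′ K≤)
  agree (inj₂ ≤K) = ≡.sym (nth-blocks-mono (≤-trans (n≤1+n (suc m)) (n≤triangular (2 + m))) (≤⇒≤′ ≤K))

h-block : ∀ k {t} → t ≤ k → h (blockStart k + t) ≡ blockLetter t
h-block k {t} t≤k = begin
  h (suc (triangular k + t))                         ≡⟨ h-suc (suc k) (+-monoʳ-< (triangular k) (s≤s t≤k)) ⟩
  nth (blocks k ++ block k) (triangular k + t)       ≡⟨ cong (λ l → nth (blocks k ++ block k) (l + t))
                                                             (length-blocks k) ⟨
  nth (blocks k ++ block k) (length (blocks k) + t)  ≡⟨ nth-++ʳ (blocks k) (block k) t ⟩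
  nth (block k) t                                    ≡⟨ nth-block t≤k ⟩
  blockLetter t                                      ∎
  where open ≡.≡-Reasoning

factor-blocks : ∀ K → factor h 1 (triangular K) ≡ blocks K
factor-blocks K = ≡.subst (λ l → factor h 1 l ≡ blocks K) (length-blocks K)
  (factor-≡ h 1 (blocks K) λ m m<∣blocks∣ → h-suc K (≡.subst (m <_) (length-blocks K) m<∣blocks∣))

factor-after-blockStart : ∀ k j → j ≤ k → factor h (suc (blockStart k)) j ≡ replicate j two
factor-after-blockStart k j j≤k = factor-const h (suc (blockStart k)) j λ m m<j →
  ≡.trans (cong h (≡.sym (+-suc (blockStart k) m))) (h-block k (≤-trans m<j j≤k))

factor-block-prefix : ∀ k j → j ≤ k → factor h (blockStart k) (suc j) ≡ block j
factor-block-prefix k j j≤k = ≡.trans (factor-suc h (blockStart k) j)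
  (cong₂ _∷_ (≡.trans (cong h (≡.sym (+-identityʳ (blockStart k)))) (h-block k z≤n))
             (factor-after-blockStart k j j≤k))

factor-block-++ : ∀ k m → factor h (blockStart k) (m + suc k) ≡ block k ++ factor h (blockStart (suc k)) m
factor-block-++ k m = begin
  factor h (blockStart k) (m + suc k)                                 ≡⟨ cong (factor h (blockStart k))
                                                                              (+-comm m (suc k)) ⟩
  factor h (blockStart k) (suc k + m)                                 ≡⟨ factor-++ h (blockStart k) (suc k) m ⟩
  factor h (blockStart k) (suc k) ++ factor h (blockStart (suc k)) m  ≡⟨ cong (_++ factor h (blockStart (suc k)) m)
                                                                              (factor-block-prefix k k ≤-refl) ⟩
  block k ++ factor h (blockStart (suc k)) m                          ∎
  where open ≡.≡-Reasoning

factor-block-end : ∀ k m → factor h (blockStart (suc k) + suc k) (suc m) ≡ two ∷ factor h (blockStart (2 + k)) m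
factor-block-end k m = ≡.trans (factor-suc h (blockStart (suc k) + suc k) m)
  (cong₂ _∷_ (h-block (suc k) ≤-refl) (cong (λ i → factor h i m) (≡.sym (+-suc (blockStart (suc k)) (suc k)))))

-- nearBlock d m is the letter m places after a position lying d places before the start of a long enough block.
nearBlock : ℕ → ℕ → Letter
nearBlock zero    m       = blockLetter m
nearBlock (suc d) zero    = two
nearBlock (suc d) (suc m) = nearBlock d m

h-nearBlock : ∀ k d m i → d ≤ k → m ≤ suc k → i + d ≡ blockStart (suc k) → h (i + m) ≡ nearBlock d m
h-nearBlock k zero m i _ m≤1+k i≡ =
  ≡.trans (cong (λ j → h (j + m)) (≡.trans (≡.sym (+-identityʳ i)) i≡)) (h-block (suc k) m≤1+k)
h-nearBlock k (suc d) (suc m) i d<k m<1+k i+1+d≡ = ≡.trans (cong h (+-suc i m))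
  (h-nearBlock k d m (suc i) (<⇒≤ d<k) (<⇒≤ m<1+k) (≡.trans (≡.sym (+-suc i d)) i+1+d≡))
h-nearBlock k (suc d) zero i d<k _ i+1+d≡ with m≤n⇒∃[o]m+o≡n d<k
... | e , ≡.refl = ≡.trans (cong h (≡.trans (+-identityʳ i) i≡)) (h-block (suc d + e) (s≤s (m≤n+m e d)))
  where
  regroup : ∀ t d e → t + suc (suc d + e) ≡ t + suc e + suc d
  regroup = solve-∀
  i≡ : i ≡ blockStart (suc d + e) + suc e
  i≡ = +-cancelʳ-≡ (suc d) i _ (≡.trans i+1+d≡ (cong suc (regroup (triangular (suc d + e)) d e)))

nearBlock-⊓ : ∀ d n m → m < n → nearBlock d m ≡ nearBlock (d ⊓ n) m
nearBlock-⊓ zero    n       m       _         = ≡.refl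
nearBlock-⊓ (suc d) (suc n) zero    _         = ≡.refl
nearBlock-⊓ (suc d) (suc n) (suc m) (s≤s m<n) = nearBlock-⊓ d n m m<n

position-before-block : ∀ i → 2 ≤ i → ∃₂ λ k d → d ≤ k × i + d ≡ blockStart (suc k)
position-before-block 1 (s≤s ())
position-before-block 2 _ = 0 , 0 , z≤n , ≡.refl
position-before-block (suc i@(suc (suc _))) _ with position-before-block i (s≤s (s≤s z≤n))
... | k , zero , _ , i≡ = suc k , suc k , ≤-refl ,
      ≡.trans (cong (λ j → suc j + suc k) (≡.trans (≡.sym (+-identityʳ i)) i≡))
              (cong suc (≡.sym (+-suc (triangular (suc k)) (suc k))))
... | k , suc d , d<k , i+1+d≡ = k , d , <⇒≤ d<k , ≡.trans (≡.sym (+-suc i d)) i+1+d≡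

factor-occurs-early : ∀ n i → ∃ λ j → j ≤ blockStart (suc n) × factor h i n ≡ factor h j n
factor-occurs-early n i with i ≤? blockStart (suc n)
... | yes i≤ = i , i≤ , ≡.refl
... | no i≰ with position-before-block i (≤-trans (s≤s (s≤s z≤n)) (≰⇒> i≰))
...   | k , d , d≤k , i+d≡ = j , m∸n≤m _ d′ , (begin
  factor h i n                 ≡⟨ factor-≡-map h i n (λ m m<n →
                                    ≡.trans (h-nearBlock k d m i d≤k (m≤1+ k m<n n≤k) i+d≡) (nearBlock-⊓ d n m m<n)) ⟩
  map (nearBlock d′) (upTo n)  ≡⟨ factor-≡-map h j n (λ m m<n →
                                    h-nearBlock n d′ m j (m⊓n≤n d n) (m≤1+ n m<n ≤-refl) j+d′≡) ⟨
  factor h j n                 ∎)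
  where
  open ≡.≡-Reasoning
  d′ : ℕ
  d′ = d ⊓ n
  j : ℕ
  j = blockStart (suc n) ∸ d′
  j+d′≡ : j + d′ ≡ blockStart (suc n)
  j+d′≡ = m∸n+n≡m (≤-trans (m⊓n≤n d n) (≤-trans (n≤1+n n) (≤-trans (n≤triangular (suc n)) (n≤1+n _))))
  n≤k : n ≤ k
  n≤k = <⇒≤ (≤-pred (triangular-cancel-< (≤-pred (≤-trans (≰⇒> i≰) (≤-trans (m≤m+n i d) (≤-reflexive i+d≡))))))
  m≤1+ : ∀ l {m} → m < n → n ≤ l → m ≤ suc l
  m≤1+ l m<n n≤l = ≤-trans (<⇒≤ m<n) (≤-trans n≤l (n≤1+n l))

earlyFactors : ℕ → List Word
earlyFactors n = applyUpTo (λ j → factor h j n) (suc (blockStart (suc n)))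

module _ {R : Rel Word 0ℓ} (R-isDecEquivalence : IsDecEquivalence R) where
  open IsDecEquivalence R-isDecEquivalence using () renaming (_≟_ to _≟R_)

  classCount : ℕ → ℕ
  classCount n = length (deduplicate _≟R_ (earlyFactors n))

  numClasses-h : ∀ n → NumClasses h R n (classCount n)
  numClasses-h n = numClasses-deduplicate R-isDecEquivalence (earlyFactors n)
    (All.applyUpTo⁺₁ _ _ λ {j} _ → j , ≡.refl)
    λ i → let (j , j≤ , i≈j) = factor-occurs-early n i
          in ≡.subst (_∈ₚ earlyFactors n) (≡.sym i≈j) (∈-applyUpTo⁺ (λ j → factor h j n) (s≤s j≤))

discrete-intermediate-value : (f : ℕ → ℕ) → (∀ i → f i ≤ suc (f (suc i))) →
                              ∀ a g {v} → v ≤ f a → f (a + g) ≤ v → ∃ λ i → f i ≡ v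
discrete-intermediate-value f f-steps a zero v≤fa fa≤v =
  a , ≤-antisym (≡.subst (λ i → f i ≤ _) (+-identityʳ a) fa≤v) v≤fa
discrete-intermediate-value f f-steps a (suc g) {v} v≤fa fa+g≤v with f a ≟ℕ v
... | yes fa≡v = a , fa≡v
... | no fa≢v  = discrete-intermediate-value f f-steps (suc a) g
                   (≤-pred (≤-trans (≤∧≢⇒< v≤fa (fa≢v ∘ ≡.sym)) (f-steps a)))
                   (≡.subst (λ i → f i ≤ v) (+-suc a g) fa+g≤v)

binom₁-replicate-two : ∀ k → binom₁ (replicate k two) one ≡ 0
binom₁-replicate-two zero    = ≡.refl
binom₁-replicate-two (suc k) = binom₁-replicate-two k

binom₁-blocks : ∀ K → binom₁ (blocks K) one ≡ K
binom₁-blocks zero    = ≡.refl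
binom₁-blocks (suc K) = ≡.trans (binom₁-++ (blocks K) (block K) one)
  (≡.trans (cong₂ _+_ (binom₁-blocks K) (cong (_+ 1) (binom₁-replicate-two K))) (+-comm K 1))

binom₁-factor-attains : ∀ K v → v ≤ K → ∃ λ i → binom₁ (factor h i (triangular K)) one ≡ v
binom₁-factor-attains K v v≤K =
  discrete-intermediate-value ones-at (λ i → binom₁-factor-slide h i n one) 1 (blockStart n)
    (≡.subst (v ≤_) (≡.sym ones-at-1) v≤K) (≡.subst (_≤ v) (≡.sym ones-after-start) z≤n)
  where
  n : ℕ
  n = triangular K
  ones-at : ℕ → ℕ
  ones-at i = binom₁ (factor h i n) one
  ones-at-1 : ones-at 1 ≡ K
  ones-at-1 = ≡.trans (cong (λ w → binom₁ w one) (factor-blocks K)) (binom₁-blocks K)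
  ones-after-start : ones-at (suc (blockStart n)) ≡ 0
  ones-after-start =
    ≡.trans (cong (λ w → binom₁ w one) (factor-after-blockStart n n ≤-refl)) (binom₁-replicate-two n)

many-abelian-classes : ∀ K {k} → NumClasses h (_∼[ 1 ]_) (triangular K) k → K < k
many-abelian-classes K {k} classes = ≡.subst (_≤ k) (length-tabulate witness)
  (numClasses-≥ (∼-isEquivalence 1) h classes (tabulate⁺ ∼₁-setoid witness-injective)
    (All.tabulate⁺ λ v → position v , ≡.refl))
  where
  ∼₁-setoid : Setoid 0ℓ 0ℓ
  ∼₁-setoid = record { isEquivalence = ∼-isEquivalence 1 }
  attained : (v : Fin (suc K)) → ∃ λ i → binom₁ (factor h i (triangular K)) one ≡ toℕ v
  attained v = binom₁-factor-attains K (toℕ v) (≤-pred (toℕ<n v))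
  position : Fin (suc K) → ℕ
  position v = proj₁ (attained v)
  witness : Fin (suc K) → Word
  witness v = factor h (position v) (triangular K)
  witness-injective : ∀ {u v} → witness u ∼[ 1 ] witness v → u ≡ v
  witness-injective {u} {v} u∼v = toℕ-injective
    (≡.trans (≡.sym (proj₂ (attained u))) (≡.trans (u∼v (one ∷ []) (s≤s z≤n)) (proj₂ (attained v))))

∷-replicate-++ : ∀ k (a : Letter) w → a ∷ (replicate k a ++ w) ≡ replicate k a ++ a ∷ w
∷-replicate-++ zero    a w = ≡.refl
∷-replicate-++ (suc k) a w = cong (a ∷_) (∷-replicate-++ k a w)

factor-12⋯ : ∀ m → IsFactor h (2 + m) (one ∷ two ∷ replicate m two)
factor-12⋯ m = blockStart (suc m) , factor-block-prefix (suc m) (suc m) ≤-refl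

factor-21⋯ : ∀ m → IsFactor h (2 + m) (two ∷ one ∷ replicate m two)
factor-21⋯ m = blockStart (suc m) + suc m , ≡.trans (factor-block-end m (suc m))
  (cong (two ∷_) (factor-block-prefix (2 + m) m (≤-trans (n≤1+n m) (n≤1+n (suc m)))))

factor-21⋯12 : ∀ j → IsFactor h (6 + j) ((two ∷ one ∷ []) ++ replicate (2 + j) two ++ (one ∷ two ∷ []))
factor-21⋯12 j = blockStart (suc j) + suc j , ≡.trans (factor-block-end j (5 + j))
  (cong (two ∷_) (≡.trans (factor-block-++ (2 + j) 2)
                          (cong (block (2 + j) ++_) (factor-block-prefix (3 + j) 1 (s≤s z≤n)))))

factor-12⋯21 : ∀ j → IsFactor h (6 + j) ((one ∷ two ∷ []) ++ replicate (2 + j) two ++ (two ∷ one ∷ []))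
factor-12⋯21 j = blockStart (4 + j) , ≡.trans (factor-block-++ (4 + j) 1)
  (≡.trans (cong (block (4 + j) ++_) (factor-block-prefix (5 + j) 0 z≤n))
           (cong (λ w → one ∷ two ∷ w) (∷-replicate-++ (2 + j) two (one ∷ []))))

proposition7p5 : ((B : ℕ) → Σ ℕ λ n → Σ ℕ λ k → BinomComplexity h 1 n k × B < k)
    × ((n : ℕ) → 6 ≤ n →
    Σ ℕ λ k₁ → Σ ℕ λ k₂ → Σ ℕ λ k₃ →
    BinomComplexity h 1 n k₁ × BinomComplexity h 2 n k₂ × FactorComplexity h n k₃
    × k₁ < k₂ × k₂ < k₃)
proposition7p5 = unbounded , separated
  where
  ∼₁ : IsDecEquivalence (_∼[ 1 ]_)
  ∼₁ = ∼-isDecEquivalence 1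
  ∼₂ : IsDecEquivalence (_∼[ 2 ]_)
  ∼₂ = ∼-isDecEquivalence 2
  ≡w : IsDecEquivalence {A = Word} _≡_
  ≡w = ≡.isDecEquivalence (≡-dec _≟_)

  unbounded : (B : ℕ) → Σ ℕ λ n → Σ ℕ λ k → BinomComplexity h 1 n k × B < k
  unbounded B = triangular B , _ , numClasses-h ∼₁ _ , many-abelian-classes B (numClasses-h ∼₁ _)

  separated : (n : ℕ) → 6 ≤ n → Σ ℕ λ k₁ → Σ ℕ λ k₂ → Σ ℕ λ k₃ →
    BinomComplexity h 1 n k₁ × BinomComplexity h 2 n k₂ × FactorComplexity h n k₃ × k₁ < k₂ × k₂ < k₃
  separated n 6≤n with j , ≡.refl ← m≤n⇒∃[o]m+o≡n 6≤n =
    _ , _ , _ , numClasses-h ∼₁ n , numClasses-h ∼₂ n , numClasses-h ≡w n ,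
    numClasses-< (∼-isEquivalence 1) ∼₂ (∼-weaken (s≤s z≤n)) h (numClasses-h ∼₁ n) (numClasses-h ∼₂ n)
      (factor-12⋯ (4 + j)) (factor-21⋯ (4 + j)) (12-∼₁-21 _) (12-≁₂-21 _) ,
    numClasses-< (∼-isEquivalence 2) ≡w ≡⇒∼ h (numClasses-h ∼₂ n) (numClasses-h ≡w n)
      (factor-21⋯12 j) (factor-12⋯21 j) (21⋯12-∼₂-12⋯21 (replicate (2 + j) two)) (λ ())
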